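{- Let $k\geq 2$, $n\geq 0$, and let $\pi=\pi(1)\cdots\pi(kn)$ and $\sigma=\sigma(1)\cdots\sigma((k-1)n)$ be, respectively, the $k$-Catalan--Spitzer permutation and the short $k$-Catalan--Spitzer permutation associated to the same $k$-Catalan--Spitzer path of order $n$. Then $\sigma$ is the pattern of the word $\pi(i_1)\pi(i_2)\cdots\pi(i_{(k-1)n})$, where $i_1<i_2<\cdots<i_{(k-1)n}$ are the ascents of $\pi$.
   Context: A $k$-Catalan--Spitzer path of order $n$ is a lattice path $(0,z'_0),(1,z'_1),\ldots,(kn+1,z'_{kn+1})$ with $z'_0=z'_{kn+1}=0$, consisting of $(k-1)n+1$ up steps $(1,n)$ and $n$ down steps $(1,-((k-1)n+1))$, with $z'_i>0$ for $1\leq i\leq kn$. Its $k$-Catalan--Spitzer permutation is the permutation $\pi$ of $\{1,\ldots,kn\}$ with $\pi(i)<\pi(j)$ iff $z'_i<z'_j$. Letting $j_1<\cdots<j_{(k-1)n}$ be the indices $j\in\{1,\ldots,kn\}$ with $z'_j<z'_{j+1}$, its short $k$-Catalan--Spitzer permutation is the permutation $\sigma$ of $\{1,\ldots,(k-1)n\}$ with $\sigma(a)<\sigma(b)$ iff $z'_{j_a}<z'_{j_b}$. An ascent of a permutation $\pi$ of $\{1,\ldots,m\}$ is an index $i\in\{1,\ldots,m-1\}$ with $\pi(i)<\pi(i+1)$. The pattern of a word $w_1\cdots w_m$ of distinct letters from an ordered set is the permutation $\tau$ of $\{1,\ldots,m\}$ with $\tau(i)<\tau(j)$ iff $w_i<w_j$.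 -}

module Defs where

open import Data.Nat as ℕ using (ℕ; zero; suc; _*_; _∸_)
open import Data.Integer as ℤ using (ℤ; +_; -_; _<_)
open import Data.Bool using (Bool; true; false)
open import Data.List using (List; []; _∷_; take; length)
open import Data.Vec using (Vec; toList)
open import Data.Fin using (Fin; toℕ)
import Data.Fin as F
open import Data.Fin.Permutation using (Permutation′; _⟨$⟩ʳ_)
open import Data.Product using (Σ; ∃; _×_)
open import Function.Bundles using (_⇔_)
open import Relation.Binary.PropositionalEquality using (_≡_)

-- A step word of a lattice path: true = up step (1, n), false = down step (1, -((k-1)n+1)).
-- The path of order n has kn+1 steps.
stepValue : ℕ → ℕ → Bool → ℤ
stepValue k n true  = + n
stepValue k n false = - (+ ((k ∸ 1) * n ℕ.+ 1))

sumSteps : ℕ → ℕ → List Bool → ℤ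
sumSteps k n []       = + 0
sumSteps k n (b ∷ bs) = stepValue k n b ℤ.+ sumSteps k n bs

height : (k n : ℕ) → Vec Bool (suc (k * n)) → ℕ → ℤ
height k n w i = sumSteps k n (take i (toList w))

countUp : List Bool → ℕ
countUp []          = 0
countUp (true ∷ bs)  = suc (countUp bs)
countUp (false ∷ bs) = countUp bs

-- k-Catalan--Spitzer path of order n: (k-1)n+1 up steps and n down steps
-- (total kn+1 steps, enforced by the Vec length), z'_0 = z'_{kn+1} = 0 and
-- z'_i > 0 for 1 ≤ i ≤ kn.
record IsCatalanSpitzerPath (k n : ℕ) (w : Vec Bool (suc (k * n))) : Set where
  field
    ups      : countUp (toList w) ≡ (k ∸ 1) * n ℕ.+ 1
    endZero  : height k n w (suc (k * n)) ≡ + 0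
    positive : (i : ℕ) → 1 ℕ.≤ i → i ℕ.≤ k * n → + 0 < height k n w i

-- Positions 1..m are encoded by Fin m (position t+1 ↦ t).

IsPattern : {A : Set} (_<ᵒ_ : A → A → Set) {m : ℕ} → (Fin m → A) → Permutation′ m → Set
IsPattern _<ᵒ_ {m} u τ = (a b : Fin m) → ((τ ⟨$⟩ʳ a) F.< (τ ⟨$⟩ʳ b)) ⇔ (u a <ᵒ u b)

IsIncreasingEnumeration : {m len : ℕ} → (Fin m → Set) → (Fin len → Fin m) → Set
IsIncreasingEnumeration {m} {len} P e =
  ((a b : Fin len) → a F.< b → e a F.< e b) ×
  ((t : Fin m) → P t ⇔ ∃ λ a → e a ≡ t)

innerHeight : (k n : ℕ) → Vec Bool (suc (k * n)) → Fin (k * n) → ℤ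
innerHeight k n w t = height k n w (suc (toℕ t))

IsCSPermutation : (k n : ℕ) → Vec Bool (suc (k * n)) → Permutation′ (k * n) → Set
IsCSPermutation k n w π = IsPattern _<_ (innerHeight k n w) π

PathAscent : (k n : ℕ) → Vec Bool (suc (k * n)) → Fin (k * n) → Set
PathAscent k n w t = height k n w (suc (toℕ t)) < height k n w (suc (suc (toℕ t)))

IsShortCSPermutation : (k n : ℕ) → Vec Bool (suc (k * n)) → Permutation′ ((k ∸ 1) * n) → Set
IsShortCSPermutation k n w σ =
  (j : Fin ((k ∸ 1) * n) → Fin (k * n)) →
  IsIncreasingEnumeration (PathAscent k n w) j →
  IsPattern _<_ (λ a → innerHeight k n w (j a)) σ

IsAscent : {m : ℕ} → Permutation′ m → Fin m → Set
IsAscent {m} π t = ∃ λ (t' : Fin m) → (toℕ t' ≡ suc (toℕ t)) × ((π ⟨$⟩ʳ t) F.< (π ⟨$⟩ʳ t'))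

-- π has the relative order of the heights z'_1 … z'_{kn}, so t < kn is an ascent of π exactly when
-- z'_t < z'_{t+1}, i.e. when step t+1 goes up; and kn is not a path ascent, since the path falls
-- from a positive height to z'_{kn+1} = 0.  So the ascents of π are exactly the path ascents
-- j_1 < … < j_{(k-1)n}, and on them π has the relative order of the heights, as σ does.  There are
-- (k-1)n of them because the first step must go up (z'_1 > 0), leaving (k-1)n up steps after it.
module Submission where

open import Defs
open import Data.Nat using (ℕ; zero; suc; _*_; _∸_; _≤_; z≤n; s≤s)
import Data.Nat.Properties as ℕₚ
open import Data.Integer as ℤ using (+_; +<+)
import Data.Integer.Properties as ℤₚ
open import Data.Bool using (Bool; true; false)
open import Data.Vec using (Vec; []; _∷_; lookup; toList)
open import Data.List using (take)
open import Data.Fin using (Fin; _<_; toℕ; fromℕ<)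
import Data.Fin.Properties as Finₚ
open import Data.Fin.Permutation using (Permutation′; _⟨$⟩ʳ_)
open import Data.Product using (Σ; ∃; _×_; _,_; proj₁; proj₂; map)
open import Data.Sum using (inj₁; inj₂)
open import Data.Empty using (⊥-elim)
open import Function using (_∘_; id)
open import Function.Bundles using (_⇔_; mk⇔; Equivalence)
open import Function.Properties.Equivalence using () renaming (sym to ⇔-sym; trans to ⇔-trans)
open import Relation.Nullary using (¬_)
open import Relation.Binary.PropositionalEquality

IsIncreasingEnumeration-resp : ∀ {m len} {P Q : Fin m → Set} {e : Fin len → Fin m} →
  (∀ t → P t ⇔ Q t) → IsIncreasingEnumeration P e → IsIncreasingEnumeration Q e
IsIncreasingEnumeration-resp P⇔Q (increasing , image) =
  increasing , λ t → ⇔-trans (⇔-sym (P⇔Q t)) (image t)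

IsPattern-subword : ∀ {A : Set} (_<ᵒ_ : A → A → Set) {m len} (u : Fin m → A)
  (π : Permutation′ m) (i : Fin len → Fin m) (σ : Permutation′ len) →
  IsPattern _<ᵒ_ u π → IsPattern _<ᵒ_ (u ∘ i) σ → IsPattern _<_ ((π ⟨$⟩ʳ_) ∘ i) σ
IsPattern-subword _ _ _ _ _ π-pattern σ-pattern a b = ⇔-trans (σ-pattern a b) (⇔-sym (π-pattern _ _))

trueIndices : ∀ {m} (v : Vec Bool m) → Fin (countUp (toList v)) → Fin m
trueIndices (true  ∷ v) Fin.zero    = Fin.zero
trueIndices (true  ∷ v) (Fin.suc a) = Fin.suc (trueIndices v a)
trueIndices (false ∷ v) a           = Fin.suc (trueIndices v a)

trueIndices-strictlyIncreasing : ∀ {m} (v : Vec Bool m) {a b} → a < b → trueIndices v a < trueIndices v b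
trueIndices-strictlyIncreasing (true  ∷ v) {Fin.zero}  {Fin.suc b} _         = s≤s z≤n
trueIndices-strictlyIncreasing (true  ∷ v) {Fin.suc a} {Fin.suc b} (s≤s a<b) = s≤s (trueIndices-strictlyIncreasing v a<b)
trueIndices-strictlyIncreasing (false ∷ v)                         a<b       = s≤s (trueIndices-strictlyIncreasing v a<b)

lookup-trueIndices : ∀ {m} (v : Vec Bool m) a → lookup v (trueIndices v a) ≡ true
lookup-trueIndices (true  ∷ v) Fin.zero    = refl
lookup-trueIndices (true  ∷ v) (Fin.suc a) = lookup-trueIndices v a
lookup-trueIndices (false ∷ v) a           = lookup-trueIndices v a

trueIndices-complete : ∀ {m} (v : Vec Bool m) t → lookup v t ≡ true → ∃ λ a → trueIndices v a ≡ t
trueIndices-complete (true  ∷ v) Fin.zero    _ = Fin.zero , refl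
trueIndices-complete (true  ∷ v) (Fin.suc t) p = map Fin.suc (cong Fin.suc) (trueIndices-complete v t p)
trueIndices-complete (false ∷ v) (Fin.suc t) p = map id (cong Fin.suc) (trueIndices-complete v t p)

trueIndices-isIncreasingEnumeration : ∀ {m} (v : Vec Bool m) →
  IsIncreasingEnumeration (λ t → lookup v t ≡ true) (trueIndices v)
trueIndices-isIncreasingEnumeration v =
  (λ _ _ → trueIndices-strictlyIncreasing v) ,
  λ t → mk⇔ (trueIndices-complete v t) (λ { (a , refl) → lookup-trueIndices v a })

countUp≤length : ∀ {m} (v : Vec Bool m) → countUp (toList v) ≤ m
countUp≤length []          = z≤n
countUp≤length (true  ∷ v) = s≤s (countUp≤length v)
countUp≤length (false ∷ v) = ℕₚ.m≤n⇒m≤1+n (countUp≤length v)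

i<i+j⇒0<j : ∀ i j → i ℤ.< i ℤ.+ j → + 0 ℤ.< j
i<i+j⇒0<j i j i<i+j = ℤₚ.≰⇒> λ j≤0 →
  ℤₚ.<⇒≱ i<i+j (subst (i ℤ.+ j ℤ.≤_) (ℤₚ.+-identityʳ i) (ℤₚ.+-monoʳ-≤ i j≤0))

i<i+j⇔0<j : ∀ i j → (i ℤ.< i ℤ.+ j) ⇔ (+ 0 ℤ.< j)
i<i+j⇔0<j i j = mk⇔ (i<i+j⇒0<j i j)
  (λ 0<j → subst (ℤ._< i ℤ.+ j) (ℤₚ.+-identityʳ i) (ℤₚ.+-monoʳ-< i 0<j))

¬0<downStep : ∀ k n → ¬ (+ 0 ℤ.< stepValue k n false)
¬0<downStep k n rewrite ℕₚ.+-comm ((k ∸ 1) * n) 1 = λ ()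

0<stepValue⇔up : ∀ k n b → (+ 0 ℤ.< stepValue k (suc n) b) ⇔ (b ≡ true)
0<stepValue⇔up k n true  = mk⇔ (λ _ → refl) (λ _ → +<+ (s≤s z≤n))
0<stepValue⇔up k n false = mk⇔ (⊥-elim ∘ ¬0<downStep k (suc n)) λ ()

sumSteps-take-suc : ∀ k n {m} (v : Vec Bool m) t →
  sumSteps k n (take (suc (toℕ t)) (toList v)) ≡
  sumSteps k n (take (toℕ t) (toList v)) ℤ.+ stepValue k n (lookup v t)
sumSteps-take-suc k n (b ∷ v) Fin.zero    = ℤₚ.+-comm (stepValue k n b) (+ 0)
sumSteps-take-suc k n (b ∷ v) (Fin.suc t) = begin
  stepValue k n b ℤ.+ sumSteps k n (take (suc (toℕ t)) (toList v))
    ≡⟨ cong (ℤ._+_ (stepValue k n b)) (sumSteps-take-suc k n v t) ⟩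
  stepValue k n b ℤ.+ (sumSteps k n (take (toℕ t) (toList v)) ℤ.+ stepValue k n (lookup v t))
    ≡⟨ ℤₚ.+-assoc (stepValue k n b) _ _ ⟨
  stepValue k n b ℤ.+ sumSteps k n (take (toℕ t) (toList v)) ℤ.+ stepValue k n (lookup v t) ∎
  where open ≡-Reasoning

pathAscent⇔up : ∀ k n b (w : Vec Bool (k * n)) t → PathAscent k n (b ∷ w) t ⇔ (lookup w t ≡ true)
pathAscent⇔up k zero    b w t = ⊥-elim (Finₚ.¬Fin0 (subst Fin (ℕₚ.*-zeroʳ k) t))
pathAscent⇔up k (suc n) b w t
  rewrite sumSteps-take-suc k (suc n) (b ∷ w) (Fin.suc t) =
  ⇔-trans (i<i+j⇔0<j _ _) (0<stepValue⇔up k n (lookup w t))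

module _ {k n w} (path : IsCatalanSpitzerPath k n w) where
  open IsCatalanSpitzerPath path

  pathAscent⇒notLast : ∀ {t} → PathAscent k n w t → suc (toℕ t) Data.Nat.< k * n
  pathAscent⇒notLast {t} ascent with ℕₚ.m≤n⇒m<n∨m≡n (Finₚ.toℕ<n t)
  ... | inj₁ notLast = notLast
  ... | inj₂ last    = ⊥-elim (ℤₚ.<-asym (positive (suc (toℕ t)) (s≤s z≤n) (ℕₚ.≤-reflexive last))
                                        (subst (height k n w (suc (toℕ t)) ℤ.<_) endsAtZero ascent))
    where
    endsAtZero : height k n w (suc (suc (toℕ t))) ≡ + 0
    endsAtZero = subst (λ j → height k n w (suc j) ≡ + 0) (sym last) endZero

  isAscent⇔pathAscent : ∀ π → IsCSPermutation k n w π → ∀ t → IsAscent π t ⇔ PathAscent k n w t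
  isAscent⇔pathAscent π π-pattern t = mk⇔ to from
    where
    heightStep : ∀ {j} → toℕ j ≡ suc (toℕ t) →
      (innerHeight k n w t ℤ.< innerHeight k n w j) ≡ PathAscent k n w t
    heightStep e = cong (λ j → innerHeight k n w t ℤ.< height k n w (suc j)) e
    to : IsAscent π t → PathAscent k n w t
    to (t' , e , π<) = subst id (heightStep e) (Equivalence.to (π-pattern t t') π<)
    from : PathAscent k n w t → IsAscent π t
    from ascent = t' , e , Equivalence.from (π-pattern t t') (subst id (sym (heightStep e)) ascent)
      where
      t' = fromℕ< (pathAscent⇒notLast ascent)
      e  = Finₚ.toℕ-fromℕ< (pathAscent⇒notLast ascent)

countUp-tail : ∀ k n {b} {w : Vec Bool (suc k * n)} →
  IsCatalanSpitzerPath (suc k) n (b ∷ w) → countUp (toList w) ≡ k * n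
countUp-tail k zero {w = w} _ =
  trans (ℕₚ.n≤0⇒n≡0 (subst (countUp (toList w) ≤_) (ℕₚ.*-zeroʳ (suc k)) (countUp≤length w)))
        (sym (ℕₚ.*-zeroʳ k))
countUp-tail k (suc n) {true} path =
  ℕₚ.suc-injective (trans (IsCatalanSpitzerPath.ups path) (ℕₚ.+-comm (k * suc n) 1))
countUp-tail k (suc n) {false} path =
  ⊥-elim (¬0<downStep (suc k) (suc n)
    (subst (+ 0 ℤ.<_) (ℤₚ.+-identityʳ _) (IsCatalanSpitzerPath.positive path 1 (s≤s z≤n) (s≤s z≤n))))

pathAscentEnumeration : ∀ k n {b} {w : Vec Bool (suc k * n)} → IsCatalanSpitzerPath (suc k) n (b ∷ w) →
  Σ (Fin (k * n) → Fin (suc k * n)) (IsIncreasingEnumeration (PathAscent (suc k) n (b ∷ w)))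
pathAscentEnumeration k n {b} {w} path =
  subst (λ len → Σ (Fin len → Fin (suc k * n)) (IsIncreasingEnumeration (PathAscent (suc k) n (b ∷ w))))
    (countUp-tail k n path)
    (trueIndices w , IsIncreasingEnumeration-resp (λ t → ⇔-sym (pathAscent⇔up (suc k) n b w t))
                                                  (trueIndices-isIncreasingEnumeration w))

lemma4p3 : (k n : ℕ) → 2 ≤ k → (w : Vec Bool (suc (k * n))) →
    IsCatalanSpitzerPath k n w →
    (π : Permutation′ (k * n)) → IsCSPermutation k n w π →
    (σ : Permutation′ ((k ∸ 1) * n)) → IsShortCSPermutation k n w σ →
    ∃ λ (i : Fin ((k ∸ 1) * n) → Fin (k * n)) →
    IsIncreasingEnumeration (IsAscent π) i ×
    IsPattern _<_ (λ a → π ⟨$⟩ʳ (i a)) σ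
lemma4p3 (suc k) n (s≤s _) (b ∷ w) path π π-pattern σ σ-pattern =
  i , IsIncreasingEnumeration-resp (⇔-sym ∘ isAscent⇔pathAscent path π π-pattern) pathAscents ,
  IsPattern-subword ℤ._<_ (innerHeight (suc k) n (b ∷ w)) π i σ π-pattern (σ-pattern i pathAscents)
  where
  i           = proj₁ (pathAscentEnumeration k n path)
  pathAscents = proj₂ (pathAscentEnumeration k n path)
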